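{- Let $G$ be a connected $(P_2\cup P_3)$-free graph and $S\subseteq V(G)$ a cutset of $G$ such that each vertex in $S$ is adjacent to at least two components of $G-S$. Then: (i) for every nontrivial clique component $D$ of $G-S$ and every vertex $x\in S$, $x$ is adjacent to $D$; (ii) for every nontrivial clique component $D$ of $G-S$ and every vertex $x\in S$, if $x$ is adjacent to at least three components of $G-S$, then $x$ is adjacent in $G$ to at least $|V(D)|-1$ vertices of $D$; (iii) if $D_1$ and $D_2$ are two nontrivial clique components of $G-S$, then for every vertex $x\in S$, either $x$ is adjacent in $G$ to at least $|V(D_i)|-1$ vertices of $D_i$ for each $i=1,2$, or $x$ is adjacent in $G$ to all vertices of $D_1$ or to all vertices of $D_2$.
   Context: Graphs are finite, simple, undirected. A cutset of $G$ is a set $S\subseteq V(G)$ such that $G-S$ (the subgraph induced on $V(G)\setminus S$) has at least two components. For $x\in S$ and a component $D$ of $G-S$, $x$ is adjacent to $D$ if $x$ is adjacent in $G$ to some vertex of $D$. A component $D$ of $G-S$ is a clique component if $V(D)$ is a clique in $G$; it is trivial if it has exactly one vertex, nontrivial otherwise. A graph is $(P_2\cup P_3)$-free if it has no induced subgraph isomorphic to the disjoint union of a path on 2 vertices and a path on 3 vertices. -}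

module Defs where

open import Data.Nat using (ℕ; _≤_; _∸_)
open import Data.Bool using (Bool; true; false)
open import Data.Fin using (Fin; zero; suc)
open import Data.Fin.Subset using (Subset; _∈_; _∉_; _∩_; ∣_∣; ⊤; Nonempty)
open import Data.Vec using (tabulate)
open import Data.Product using (Σ; ∃; _×_; _,_)
open import Relation.Binary.PropositionalEquality using (_≡_; _≢_)
open import Function.Definitions using (Injective)

record Graph (n : ℕ) : Set where
  field
    adj   : Fin n → Fin n → Bool
    sym   : ∀ u v → adj u v ≡ adj v u
    irrefl : ∀ u → adj u u ≡ false
open Graph public

module _ {n : ℕ} (G : Graph n) where

  data PathIn (X : Subset n) : Fin n → Fin n → Set where
    here : ∀ {u} → u ∈ X → PathIn X u u
    step : ∀ {u w v} → u ∈ X → adj G u w ≡ true → PathIn X w v → PathIn X u v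

  Connected : Set
  Connected = ∀ u v → PathIn ⊤ u v

  HasInduced : ∀ {m} → Graph m → Set
  HasInduced {m} H = Σ (Fin m → Fin n) λ f →
    Injective _≡_ _≡_ f × (∀ i j → adj G (f i) (f j) ≡ adj H i j)

  -- C is (the vertex set of) a component of G - S: nonempty, disjoint from S,
  -- connected inside C, and closed under adjacency in G - S (maximality).
  IsComponent : Subset n → Subset n → Set
  IsComponent S C =
    Nonempty C ×
    (∀ u → u ∈ C → u ∉ S) ×
    (∀ u v → u ∈ C → v ∈ C → PathIn C u v) ×
    (∀ u v → u ∈ C → v ∉ S → adj G u v ≡ true → v ∈ C)

  IsCutset : Subset n → Set
  IsCutset S = ∃ λ C₁ → ∃ λ C₂ → IsComponent S C₁ × IsComponent S C₂ × C₁ ≢ C₂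

  AdjTo : Fin n → Subset n → Set
  AdjTo x D = ∃ λ v → v ∈ D × adj G x v ≡ true

  AdjToAtLeastTwo : Subset n → Fin n → Set
  AdjToAtLeastTwo S x = ∃ λ C₁ → ∃ λ C₂ →
    IsComponent S C₁ × IsComponent S C₂ × C₁ ≢ C₂ × AdjTo x C₁ × AdjTo x C₂

  AdjToAtLeastThree : Subset n → Fin n → Set
  AdjToAtLeastThree S x = ∃ λ C₁ → ∃ λ C₂ → ∃ λ C₃ →
    IsComponent S C₁ × IsComponent S C₂ × IsComponent S C₃ ×
    C₁ ≢ C₂ × C₁ ≢ C₃ × C₂ ≢ C₃ ×
    AdjTo x C₁ × AdjTo x C₂ × AdjTo x C₃

  IsClique : Subset n → Set
  IsClique D = ∀ u v → u ∈ D → v ∈ D → u ≢ v → adj G u v ≡ true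

  NontrivCliqueComp : Subset n → Subset n → Set
  NontrivCliqueComp S D = IsComponent S D × IsClique D × 2 ≤ ∣ D ∣

  N : Fin n → Subset n
  N x = tabulate (adj G x)

  AlmostComplete : Fin n → Subset n → Set
  AlmostComplete x D = ∣ D ∣ ∸ 1 ≤ ∣ D ∩ N x ∣

  CompleteTo : Fin n → Subset n → Set
  CompleteTo x D = ∀ v → v ∈ D → adj G x v ≡ true

-- P₂ ∪ P₃ on vertices 0..4: edges 0-1, 2-3, 3-4.
p2p3adj : Fin 5 → Fin 5 → Bool
p2p3adj zero (suc zero) = true
p2p3adj (suc zero) zero = true
p2p3adj (suc (suc zero)) (suc (suc (suc zero))) = true
p2p3adj (suc (suc (suc zero))) (suc (suc zero)) = true
p2p3adj (suc (suc (suc zero))) (suc (suc (suc (suc zero)))) = true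
p2p3adj (suc (suc (suc (suc zero)))) (suc (suc (suc zero))) = true
p2p3adj _ _ = false

P2∪P3 : Graph 5
P2∪P3 = record { adj = p2p3adj ; sym = s ; irrefl = i }
  where
  s : ∀ u v → p2p3adj u v ≡ p2p3adj v u
  s zero zero = _≡_.refl
  s zero (suc zero) = _≡_.refl
  s zero (suc (suc zero)) = _≡_.refl
  s zero (suc (suc (suc zero))) = _≡_.refl
  s zero (suc (suc (suc (suc zero)))) = _≡_.refl
  s (suc zero) zero = _≡_.refl
  s (suc zero) (suc zero) = _≡_.refl
  s (suc zero) (suc (suc zero)) = _≡_.refl
  s (suc zero) (suc (suc (suc zero))) = _≡_.refl
  s (suc zero) (suc (suc (suc (suc zero)))) = _≡_.refl
  s (suc (suc zero)) zero = _≡_.refl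
  s (suc (suc zero)) (suc zero) = _≡_.refl
  s (suc (suc zero)) (suc (suc zero)) = _≡_.refl
  s (suc (suc zero)) (suc (suc (suc zero))) = _≡_.refl
  s (suc (suc zero)) (suc (suc (suc (suc zero)))) = _≡_.refl
  s (suc (suc (suc zero))) zero = _≡_.refl
  s (suc (suc (suc zero))) (suc zero) = _≡_.refl
  s (suc (suc (suc zero))) (suc (suc zero)) = _≡_.refl
  s (suc (suc (suc zero))) (suc (suc (suc zero))) = _≡_.refl
  s (suc (suc (suc zero))) (suc (suc (suc (suc zero)))) = _≡_.refl
  s (suc (suc (suc (suc zero)))) zero = _≡_.refl
  s (suc (suc (suc (suc zero)))) (suc zero) = _≡_.refl
  s (suc (suc (suc (suc zero)))) (suc (suc zero)) = _≡_.refl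
  s (suc (suc (suc (suc zero)))) (suc (suc (suc zero))) = _≡_.refl
  s (suc (suc (suc (suc zero)))) (suc (suc (suc (suc zero)))) = _≡_.refl
  i : ∀ u → p2p3adj u u ≡ false
  i zero = _≡_.refl
  i (suc zero) = _≡_.refl
  i (suc (suc zero)) = _≡_.refl
  i (suc (suc (suc zero))) = _≡_.refl
  i (suc (suc (suc (suc zero)))) = _≡_.refl

P2∪P3-free : ∀ {n} → Graph n → Set
P2∪P3-free G = HasInduced G P2∪P3 → Data.Empty.⊥
  where import Data.Empty

module Submission where

-- If x misses two vertices
-- a, b of a clique component D, the edge ab is anticomplete to x and to every vertex outside
-- D ∪ S. An induced path u – x – w with u, w in two further components then gives P₂ ∪ P₃;
-- this yields (ii), and (i) since |D| ≥ 2. So does x – w – y for a neighbour w and a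
-- non-neighbour y of x in another clique component, which yields (iii) once (i) provides w.

open import Defs hiding (sym)
open import Data.Nat using (ℕ; _≤_; _<_; _∸_; z≤n; s≤s)
open import Data.Nat.Properties using (≤-trans; <⇒≢; m≤n+m∸n; ∸-monoˡ-≤)
open import Data.Bool using (true; false)
open import Data.Bool.Properties using (¬-not) renaming (_≟_ to _≟ᵇ_)
open import Data.Fin using (Fin; zero; suc; #_)
open import Data.Fin.Properties using (all?; suc-injective) renaming (_≟_ to _≟ᶠ_)
open import Data.Fin.Subset
  using (Subset; inside; outside; _∈_; _∉_; _⊆_; _∩_; ∣_∣; Nonempty)
open import Data.Fin.Subset.Properties
  using ( ⊆-antisym; drop-there; out⊆; in⊆in; x∈p∩q⁺; x∈p∩q⁻; p⊆q⇒∣p∣≤∣q∣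
        ; nonempty?; Empty-unique; ∣⊥∣≡0)
open import Data.Vec using ([]; _∷_; here; there; lookup)
open import Data.Vec.Properties using (≡-dec; []=⇒lookup; lookup⇒[]=; lookup∘tabulate)
open import Data.Product using (_×_; _,_; ∃; ∃₂)
open import Data.Sum using (_⊎_; inj₁; inj₂)
open import Data.Sum.Base as Sum using ()
open import Function using (id; _∘_)
open import Function.Definitions using (Injective)
open import Relation.Nullary using (yes; no; contradiction)
open import Relation.Nullary.Decidable using (toWitness; _→-dec_; _⊎-dec_; _×-dec_)
open import Relation.Binary.PropositionalEquality
  using (_≡_; _≢_; refl; sym; trans; cong)

0<∣p∣⇒Nonempty : ∀ {n} (p : Subset n) → 0 < ∣ p ∣ → Nonempty p
0<∣p∣⇒Nonempty {n} p 0<∣p∣ with nonempty? p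
... | yes p≢∅ = p≢∅
... | no  p≡∅ =
  contradiction (sym (trans (cong ∣_∣ (Empty-unique p≡∅)) (∣⊥∣≡0 n))) (<⇒≢ 0<∣p∣)

∃∉-there : ∀ {n s t} {p q : Subset n} →
  (∃ λ a → a ∈ p × a ∉ q) → ∃ λ a → a ∈ s ∷ p × a ∉ t ∷ q
∃∉-there (a , a∈p , a∉q) = suc a , there a∈p , a∉q ∘ drop-there

⊆-or-∃∉ : ∀ {n} (p q : Subset n) → p ⊆ q ⊎ ∃ λ a → a ∈ p × a ∉ q
⊆-or-∃∉ [] [] = inj₁ id
⊆-or-∃∉ (outside ∷ p) (_ ∷ q) = Sum.map out⊆ ∃∉-there (⊆-or-∃∉ p q)
⊆-or-∃∉ (inside ∷ p) (inside ∷ q) = Sum.map in⊆in ∃∉-there (⊆-or-∃∉ p q)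
⊆-or-∃∉ (inside ∷ p) (outside ∷ q) = inj₂ (zero , here , λ ())

p⊆q⇒∣p∣≤∣p∩q∣ : ∀ {n} {p q : Subset n} → p ⊆ q → ∣ p ∣ ≤ ∣ p ∩ q ∣
p⊆q⇒∣p∣≤∣p∩q∣ p⊆q = p⊆q⇒∣p∣≤∣q∣ (λ x∈p → x∈p∩q⁺ (x∈p , p⊆q x∈p))

Two∉ : ∀ {n} → Subset n → Subset n → Set
Two∉ p q = ∃₂ λ a b → a ≢ b × a ∈ p × b ∈ p × a ∉ q × b ∉ q

two∉-there : ∀ {n s t} {p q : Subset n} → Two∉ p q → Two∉ (s ∷ p) (t ∷ q)
two∉-there (a , b , a≢b , a∈p , b∈p , a∉q , b∉q) =
  suc a , suc b , a≢b ∘ suc-injective , there a∈p , there b∈p ,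
  a∉q ∘ drop-there , b∉q ∘ drop-there

∣p∣∸1≤∣p∩q∣-or-two∉ : ∀ {n} (p q : Subset n) → ∣ p ∣ ∸ 1 ≤ ∣ p ∩ q ∣ ⊎ Two∉ p q
∣p∣∸1≤∣p∩q∣-or-two∉ [] [] = inj₁ z≤n
∣p∣∸1≤∣p∩q∣-or-two∉ (outside ∷ p) (_ ∷ q) =
  Sum.map id two∉-there (∣p∣∸1≤∣p∩q∣-or-two∉ p q)
∣p∣∸1≤∣p∩q∣-or-two∉ (inside ∷ p) (inside ∷ q) =
  Sum.map (λ le → ≤-trans (m≤n+m∸n ∣ p ∣ 1) (s≤s le)) two∉-there
          (∣p∣∸1≤∣p∩q∣-or-two∉ p q)
∣p∣∸1≤∣p∩q∣-or-two∉ (inside ∷ p) (outside ∷ q) with ⊆-or-∃∉ p q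
... | inj₁ p⊆q = inj₁ (p⊆q⇒∣p∣≤∣p∩q∣ p⊆q)
... | inj₂ (a , a∈p , a∉q) =
  inj₂ (zero , suc a , (λ ()) , here , there a∈p , (λ ()) , a∉q ∘ drop-there)

SameNeighbours : ∀ {m} → Graph m → Fin m → Fin m → Set
SameNeighbours H i j = ∀ k → adj H i k ≡ adj H j k

P2∪P3-twins : ∀ i j → SameNeighbours P2∪P3 i j →
  i ≡ j ⊎ (i ≡ # 2 × j ≡ # 4) ⊎ (i ≡ # 4 × j ≡ # 2)
P2∪P3-twins = toWitness {a? = all? λ i → all? λ j →
  all? (λ k → adj P2∪P3 i k ≟ᵇ adj P2∪P3 j k) →-dec
  (i ≟ᶠ j ⊎-dec (i ≟ᶠ # 2 ×-dec j ≟ᶠ # 4) ⊎-dec (i ≟ᶠ # 4 ×-dec j ≟ᶠ # 2))} _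

module _ {n : ℕ} (G : Graph n) where

  adj-sym : ∀ {u v b} → adj G u v ≡ b → adj G v u ≡ b
  adj-sym {u} {v} e = trans (Graph.sym G v u) e

  ∈N⇒adj : ∀ {x v} → v ∈ N G x → adj G x v ≡ true
  ∈N⇒adj {x} {v} v∈N = trans (sym (lookup∘tabulate (adj G x) v)) ([]=⇒lookup v∈N)

  ∉N⇒¬adj : ∀ {x v} → v ∉ N G x → adj G x v ≡ false
  ∉N⇒¬adj {x} {v} v∉N =
    ¬-not (v∉N ∘ lookup⇒[]= v (N G x) ∘ trans (lookup∘tabulate (adj G x) v))

  ⊆N⇒CompleteTo : ∀ {x D} → D ⊆ N G x → CompleteTo G x D
  ⊆N⇒CompleteTo D⊆N v v∈D = ∈N⇒adj (D⊆N v∈D)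

  AlmostComplete⇒AdjTo : ∀ {x D} → 2 ≤ ∣ D ∣ → AlmostComplete G x D → AdjTo G x D
  AlmostComplete⇒AdjTo {x} {D} 2≤∣D∣ almost
    with 0<∣p∣⇒Nonempty (D ∩ N G x) (≤-trans (∸-monoˡ-≤ 1 2≤∣D∣) almost)
  ... | v , v∈D∩N with x∈p∩q⁻ D (N G x) v∈D∩N
  ... | v∈D , v∈N = v , v∈D , ∈N⇒adj v∈N

  path-source∈ : ∀ {X u v} → PathIn G X u v → u ∈ X
  path-source∈ (here u∈X) = u∈X
  path-source∈ (step u∈X _ _) = u∈X

  module _ {S : Subset n} where

    path-stays-in-component : ∀ {X C u v} → (∀ w → w ∈ X → w ∉ S) →
      IsComponent G S C → PathIn G X u v → u ∈ C → v ∈ C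
    path-stays-in-component X∩S≡∅ C-comp (here _) u∈C = u∈C
    path-stays-in-component X∩S≡∅ C-comp@(_ , _ , _ , closed) (step {u} {w} _ uw path) u∈C =
      path-stays-in-component X∩S≡∅ C-comp path
        (closed u w u∈C (X∩S≡∅ w (path-source∈ path)) uw)

    components-meeting-equal : ∀ {C C' v} → IsComponent G S C → IsComponent G S C' →
      v ∈ C → v ∈ C' → C ≡ C'
    components-meeting-equal {v = v}
      C-comp@(_ , C∩S≡∅ , C-conn , _) C'-comp@(_ , C'∩S≡∅ , C'-conn , _) v∈C v∈C' =
      ⊆-antisym
        (λ {u} u∈C → path-stays-in-component C∩S≡∅ C'-comp (C-conn v u v∈C u∈C) v∈C')
        (λ {u} u∈C' → path-stays-in-component C'∩S≡∅ C-comp (C'-conn v u v∈C' u∈C') v∈C)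

    distinct-components-nonadjacent : ∀ {C C' u w} → IsComponent G S C → IsComponent G S C' →
      C ≢ C' → u ∈ C → w ∈ C' → adj G u w ≡ false
    distinct-components-nonadjacent {u = u} {w}
      C-comp@(_ , _ , _ , closed) C'-comp@(_ , C'∩S≡∅ , _ , _) C≢C' u∈C w∈C' =
      ¬-not λ uw → C≢C'
        (components-meeting-equal C-comp C'-comp (closed u w u∈C (C'∩S≡∅ w w∈C') uw) w∈C')

    distinct-components-disjoint : ∀ {C C' u w} → IsComponent G S C → IsComponent G S C' →
      C ≢ C' → u ∈ C → w ∈ C' → u ≢ w
    distinct-components-disjoint C-comp C'-comp C≢C' u∈C w∈C' refl =
      C≢C' (components-meeting-equal C-comp C'-comp u∈C w∈C')

    component-avoids-cutset : ∀ {C x u} → IsComponent G S C → x ∈ S → u ∈ C → x ≢ u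
    component-avoids-cutset (_ , C∩S≡∅ , _ , _) x∈S u∈C refl = C∩S≡∅ _ u∈C x∈S

  ≡-image⇒SameNeighbours : ∀ {m} {H : Graph m} (f : Fin m → Fin n) →
    (∀ i j → adj G (f i) (f j) ≡ adj H i j) → ∀ {i j} → f i ≡ f j → SameNeighbours H i j
  ≡-image⇒SameNeighbours f pres {i} {j} fi≡fj k =
    trans (sym (pres i k)) (trans (cong (λ v → adj G v (f k)) fi≡fj) (pres j k))

  -- The vertices a, b, u, x, w play the roles 0, …, 4 of P₂ ∪ P₃; as 2 and 4 are the only
  -- distinct twins there, u ≢ w is all that injectivity needs.
  induced-P2∪P3 : ∀ {a b u x w} → adj G a b ≡ true → adj G u x ≡ true → adj G x w ≡ true →
    adj G u w ≡ false → u ≢ w →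
    adj G a u ≡ false → adj G a x ≡ false → adj G a w ≡ false →
    adj G b u ≡ false → adj G b x ≡ false → adj G b w ≡ false →
    HasInduced G P2∪P3
  induced-P2∪P3 {a} {b} {u} {x} {w} ab ux xw uw u≢w au ax aw bu bx bw = f , injective , pres
    where
    f : Fin 5 → Fin n
    f = lookup (a ∷ b ∷ u ∷ x ∷ w ∷ [])

    pres : ∀ i j → adj G (f i) (f j) ≡ adj P2∪P3 i j
    pres zero zero = irrefl G a
    pres zero (suc zero) = ab
    pres zero (suc (suc zero)) = au
    pres zero (suc (suc (suc zero))) = ax
    pres zero (suc (suc (suc (suc zero)))) = aw
    pres (suc zero) zero = adj-sym ab
    pres (suc zero) (suc zero) = irrefl G b
    pres (suc zero) (suc (suc zero)) = bu
    pres (suc zero) (suc (suc (suc zero))) = bx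
    pres (suc zero) (suc (suc (suc (suc zero)))) = bw
    pres (suc (suc zero)) zero = adj-sym au
    pres (suc (suc zero)) (suc zero) = adj-sym bu
    pres (suc (suc zero)) (suc (suc zero)) = irrefl G u
    pres (suc (suc zero)) (suc (suc (suc zero))) = ux
    pres (suc (suc zero)) (suc (suc (suc (suc zero)))) = uw
    pres (suc (suc (suc zero))) zero = adj-sym ax
    pres (suc (suc (suc zero))) (suc zero) = adj-sym bx
    pres (suc (suc (suc zero))) (suc (suc zero)) = adj-sym ux
    pres (suc (suc (suc zero))) (suc (suc (suc zero))) = irrefl G x
    pres (suc (suc (suc zero))) (suc (suc (suc (suc zero)))) = xw
    pres (suc (suc (suc (suc zero)))) zero = adj-sym aw
    pres (suc (suc (suc (suc zero)))) (suc zero) = adj-sym bw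
    pres (suc (suc (suc (suc zero)))) (suc (suc zero)) = adj-sym uw
    pres (suc (suc (suc (suc zero)))) (suc (suc (suc zero))) = adj-sym xw
    pres (suc (suc (suc (suc zero)))) (suc (suc (suc (suc zero)))) = irrefl G w

    injective : Injective _≡_ _≡_ f
    injective {i} {j} fi≡fj
      with P2∪P3-twins i j (≡-image⇒SameNeighbours {H = P2∪P3} f pres fi≡fj)
    ... | inj₁ i≡j = i≡j
    ... | inj₂ (inj₁ (refl , refl)) = contradiction fi≡fj u≢w
    ... | inj₂ (inj₂ (refl , refl)) = contradiction (sym fi≡fj) u≢w

  module _ {S : Subset n} (P-free : P2∪P3-free G) where

    AlmostComplete-if-adjacent-to-two-others : ∀ {D C C' x} →
      IsComponent G S D → IsClique G D →
      IsComponent G S C → IsComponent G S C' → C ≢ C' → C ≢ D → C' ≢ D →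
      AdjTo G x C → AdjTo G x C' → AlmostComplete G x D
    AlmostComplete-if-adjacent-to-two-others {D} {x = x}
      D-comp D-clique C-comp C'-comp C≢C' C≢D C'≢D (u , u∈C , xu) (w , w∈C' , xw)
      with ∣p∣∸1≤∣p∩q∣-or-two∉ D (N G x)
    ... | inj₁ almost = almost
    ... | inj₂ (a , b , a≢b , a∈D , b∈D , a∉N , b∉N) = contradiction
      (induced-P2∪P3 (D-clique a b a∈D b∈D a≢b) (adj-sym xu) xw
        (distinct-components-nonadjacent C-comp C'-comp C≢C' u∈C w∈C')
        (distinct-components-disjoint C-comp C'-comp C≢C' u∈C w∈C')
        (D↮C a∈D) (adj-sym (∉N⇒¬adj a∉N)) (D↮C' a∈D)
        (D↮C b∈D) (adj-sym (∉N⇒¬adj b∉N)) (D↮C' b∈D))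
      P-free
      where
      D↮C : ∀ {v} → v ∈ D → adj G v u ≡ false
      D↮C v∈D = distinct-components-nonadjacent D-comp C-comp (C≢D ∘ sym) v∈D u∈C
      D↮C' : ∀ {v} → v ∈ D → adj G v w ≡ false
      D↮C' v∈D = distinct-components-nonadjacent D-comp C'-comp (C'≢D ∘ sym) v∈D w∈C'

    AlmostComplete-if-mixed-on-other-clique : ∀ {D₁ D₂ x w y} →
      IsComponent G S D₁ → IsClique G D₁ → IsComponent G S D₂ → IsClique G D₂ → D₁ ≢ D₂ →
      x ∈ S → w ∈ D₂ → adj G x w ≡ true → y ∈ D₂ → adj G x y ≡ false →
      AlmostComplete G x D₁
    AlmostComplete-if-mixed-on-other-clique {D₁} {D₂} {x} {w} {y}
      D₁-comp D₁-clique D₂-comp D₂-clique D₁≢D₂ x∈S w∈D₂ xw y∈D₂ xy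
      with ∣p∣∸1≤∣p∩q∣-or-two∉ D₁ (N G x)
    ... | inj₁ almost = almost
    ... | inj₂ (a , b , a≢b , a∈D₁ , b∈D₁ , a∉N , b∉N) = contradiction
      (induced-P2∪P3 (D₁-clique a b a∈D₁ b∈D₁ a≢b) xw
        (D₂-clique w y w∈D₂ y∈D₂ λ { refl → contradiction (trans (sym xw) xy) λ () })
        xy (component-avoids-cutset D₂-comp x∈S y∈D₂)
        (adj-sym (∉N⇒¬adj a∉N)) (D₁↮D₂ a∈D₁ w∈D₂) (D₁↮D₂ a∈D₁ y∈D₂)
        (adj-sym (∉N⇒¬adj b∉N)) (D₁↮D₂ b∈D₁ w∈D₂) (D₁↮D₂ b∈D₁ y∈D₂))
      P-free
      where
      D₁↮D₂ : ∀ {u v} → u ∈ D₁ → v ∈ D₂ → adj G u v ≡ false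
      D₁↮D₂ = distinct-components-nonadjacent D₁-comp D₂-comp D₁≢D₂

    AdjTo-NontrivCliqueComp : (∀ x → x ∈ S → AdjToAtLeastTwo G S x) →
      (D : Subset n) (x : Fin n) → NontrivCliqueComp G S D → x ∈ S → AdjTo G x D
    AdjTo-NontrivCliqueComp two D x (D-comp , D-clique , 2≤∣D∣) x∈S
      with two x x∈S
    ... | C , C' , C-comp , C'-comp , C≢C' , x↔C , x↔C'
      with ≡-dec _≟ᵇ_ C D | ≡-dec _≟ᵇ_ C' D
    ... | yes refl | _        = x↔C
    ... | no _     | yes refl = x↔C'
    ... | no C≢D   | no C'≢D  = AlmostComplete⇒AdjTo 2≤∣D∣
      (AlmostComplete-if-adjacent-to-two-others D-comp D-clique
        C-comp C'-comp C≢C' C≢D C'≢D x↔C x↔C')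

    AlmostComplete-if-adjacent-to-three : (D : Subset n) (x : Fin n) →
      NontrivCliqueComp G S D → AdjToAtLeastThree G S x → AlmostComplete G x D
    AlmostComplete-if-adjacent-to-three D _ (D-comp , D-clique , _)
      (C₁ , C₂ , C₃ , C₁-comp , C₂-comp , C₃-comp , C₁≢C₂ , C₁≢C₃ , C₂≢C₃ , x↔C₁ , x↔C₂ , x↔C₃)
      with ≡-dec _≟ᵇ_ C₁ D | ≡-dec _≟ᵇ_ C₂ D
    ... | yes refl | _ = AlmostComplete-if-adjacent-to-two-others D-comp D-clique
      C₂-comp C₃-comp C₂≢C₃ (C₁≢C₂ ∘ sym) (C₁≢C₃ ∘ sym) x↔C₂ x↔C₃
    ... | no C₁≢D | yes refl = AlmostComplete-if-adjacent-to-two-others D-comp D-clique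
      C₁-comp C₃-comp C₁≢C₃ C₁≢D (C₂≢C₃ ∘ sym) x↔C₁ x↔C₃
    ... | no C₁≢D | no C₂≢D = AlmostComplete-if-adjacent-to-two-others D-comp D-clique
      C₁-comp C₂-comp C₁≢C₂ C₁≢D C₂≢D x↔C₁ x↔C₂

    AlmostComplete-or-CompleteTo : (∀ x → x ∈ S → AdjToAtLeastTwo G S x) →
      (D₁ D₂ : Subset n) → NontrivCliqueComp G S D₁ → NontrivCliqueComp G S D₂ → D₁ ≢ D₂ →
      (x : Fin n) → x ∈ S →
      (AlmostComplete G x D₁ × AlmostComplete G x D₂) ⊎
      (CompleteTo G x D₁ ⊎ CompleteTo G x D₂)
    AlmostComplete-or-CompleteTo two D₁ D₂
      D₁-ncc@(D₁-comp , D₁-clique , _) D₂-ncc@(D₂-comp , D₂-clique , _) D₁≢D₂ x x∈S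
      with ⊆-or-∃∉ D₁ (N G x) | ⊆-or-∃∉ D₂ (N G x)
    ... | inj₁ D₁⊆N | _         = inj₂ (inj₁ (⊆N⇒CompleteTo D₁⊆N))
    ... | inj₂ _    | inj₁ D₂⊆N = inj₂ (inj₂ (⊆N⇒CompleteTo D₂⊆N))
    ... | inj₂ (y₁ , y₁∈D₁ , y₁∉N) | inj₂ (y₂ , y₂∈D₂ , y₂∉N)
      with AdjTo-NontrivCliqueComp two D₁ x D₁-ncc x∈S
         | AdjTo-NontrivCliqueComp two D₂ x D₂-ncc x∈S
    ... | w₁ , w₁∈D₁ , xw₁ | w₂ , w₂∈D₂ , xw₂ = inj₁
      ( AlmostComplete-if-mixed-on-other-clique D₁-comp D₁-clique D₂-comp D₂-clique D₁≢D₂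
          x∈S w₂∈D₂ xw₂ y₂∈D₂ (∉N⇒¬adj y₂∉N)
      , AlmostComplete-if-mixed-on-other-clique D₂-comp D₂-clique D₁-comp D₁-clique
          (D₁≢D₂ ∘ sym)
          x∈S w₁∈D₁ xw₁ y₁∈D₁ (∉N⇒¬adj y₁∉N))

lemma2p5 : ∀ {n} (G : Graph n) (S : Subset n) →
    Connected G → P2∪P3-free G → IsCutset G S →
    (∀ x → x ∈ S → AdjToAtLeastTwo G S x) →
    ((D : Subset n) (x : Fin n) → NontrivCliqueComp G S D → x ∈ S → AdjTo G x D)
    × ((D : Subset n) (x : Fin n) → NontrivCliqueComp G S D → x ∈ S →
        AdjToAtLeastThree G S x → AlmostComplete G x D)
    × ((D₁ D₂ : Subset n) → NontrivCliqueComp G S D₁ → NontrivCliqueComp G S D₂ → D₁ ≢ D₂ →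
        (x : Fin n) → x ∈ S →
        (AlmostComplete G x D₁ × AlmostComplete G x D₂) ⊎ (CompleteTo G x D₁ ⊎ CompleteTo G x D₂))
lemma2p5 G S _ P-free _ two =
    AdjTo-NontrivCliqueComp G P-free two
  , (λ D x D-ncc _ → AlmostComplete-if-adjacent-to-three G P-free D x D-ncc)
  , AlmostComplete-or-CompleteTo G P-free two
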